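{- Let $G$ be a finite, simple, undirected, connected bipartite graph on $n\geq 4$ vertices with no pair of false-twin vertices. Then $G$ has at least $\lceil \frac{n}{2} \rceil$ bicliques.
   Context: All graphs are finite, simple, undirected and connected (standing assumption of the paper). A biclique of $G$ is a maximal (with respect to vertex-set inclusion) induced subgraph of $G$ that is a complete bipartite graph $K_{p,q}$ with $p,q\geq 1$; bicliques are counted as distinct vertex sets. Two distinct vertices $u,v$ are false-twins if $N(u)=N(v)$, where $N(\cdot)$ denotes the open neighborhood. -}

module Defs where

open import Data.Nat using (ℕ; suc)
open import Data.Fin using (Fin)
open import Data.Bool using (Bool; true; false)
open import Data.List using (List; []; _∷_)
open import Data.Product using (Σ; ∃; _×_; _,_)
open import Data.Sum using (_⊎_)
open import Data.Fin.Subset using (Subset; _∈_; _∉_; _⊆_; _⊂_; Nonempty)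
open import Relation.Binary.PropositionalEquality using (_≡_; _≢_)
open import Relation.Nullary using (¬_)

record Graph (n : ℕ) : Set where
  field
    adj   : Fin n → Fin n → Bool
    sym   : ∀ u v → adj u v ≡ adj v u
    irrefl : ∀ u → adj u u ≡ false

open Graph public

module _ {n : ℕ} (G : Graph n) where

  Adj : Fin n → Fin n → Set
  Adj u v = adj G u v ≡ true

  data Walk : Fin n → Fin n → Set where
    here : ∀ {u} → Walk u u
    step : ∀ {u v w} → Adj u v → Walk v w → Walk u w

  Connected : Set
  Connected = ∀ u v → Walk u v

  Bipartite : Set
  Bipartite = Σ (Fin n → Bool) λ c → ∀ u v → Adj u v → c u ≢ c v

  FalseTwins : Fin n → Fin n → Set
  FalseTwins u v = u ≢ v × (∀ w → adj G u w ≡ adj G v w)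

  NoFalseTwins : Set
  NoFalseTwins = ∀ u v → ¬ FalseTwins u v

  IsCompleteBipartiteInduced : Subset n → Set
  IsCompleteBipartiteInduced S =
    ∃ λ (A : Subset n) → ∃ λ (B : Subset n) →
      Nonempty A × Nonempty B ×
      (∀ x → x ∈ S → (x ∈ A × x ∉ B) ⊎ (x ∈ B × x ∉ A)) ×
      A ⊆ S × B ⊆ S ×
      (∀ a b → a ∈ A → b ∈ B → Adj a b) ×
      (∀ a a′ → a ∈ A → a′ ∈ A → ¬ Adj a a′) ×
      (∀ b b′ → b ∈ B → b′ ∈ B → ¬ Adj b b′)

  IsBiclique : Subset n → Set
  IsBiclique S = IsCompleteBipartiteInduced S × (∀ T → S ⊂ T → ¬ IsCompleteBipartiteInduced T)

-- Fix a proper 2-colouring. For a vertex v (which has a neighbour, as G is connected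
-- on at least two vertices) the vertices u with N(v) ⊆ N(u) all have the colour of v,
-- and together with N(v) they form a biclique B(v): any larger complete bipartite set
-- would have v on one side, forcing its other side into N(v) and its own side into
-- {u : N(v) ⊆ N(u)}. Inside one colour class, B(v) recovers N(v) as its part of the
-- opposite colour, so v ↦ B(v) is injective there unless two vertices are false twins.
-- The larger colour class has at least ⌈n/2⌉ vertices.
module Submission where

open import Defs hiding (sym)
open import Data.Bool using (Bool; true)
import Data.Bool as Bool
open import Data.Bool.Properties using (¬-not; ⇔→≡)
open import Data.Empty using (⊥; ⊥-elim)
open import Data.Fin using (Fin; zero; suc)
open import Data.Fin.Properties using (all?)
open import Data.Fin.Subset using (Subset; _∈_; _⊆_; _∪_)
open import Data.Fin.Subset.Properties using (p⊆p∪q; q⊆p∪q; x∈p∪q⁻)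
open import Data.List using (List; []; _∷_; length; filter; map; allFin)
open import Data.List.Properties using (length-map; length-tabulate)
open import Data.List.Relation.Unary.All as All using (All; []; _∷_)
import Data.List.Relation.Unary.All.Properties as Allₚ
open import Data.List.Relation.Unary.AllPairs using (AllPairs; []; _∷_)
import Data.List.Relation.Unary.AllPairs.Properties as AllPairsₚ
open import Data.List.Relation.Unary.Unique.Propositional using (Unique)
import Data.List.Relation.Unary.Unique.Propositional.Properties as Uniqueₚ
open import Data.Nat using (ℕ; suc; _+_; _≤_; _⊔_; ⌈_/2⌉; z≤n; s≤s)
open import Data.Nat.Properties
  using (+-suc; ≤-trans; ≤-reflexive; +-mono-≤; m≤m⊔n; m≤n⊔m; ⌈n/2⌉-mono; n≡⌈n+n/2⌉; ⊔-sel)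
open import Data.Product using (Σ; ∃; _×_; _,_; proj₁)
open import Data.Sum as Sum using (_⊎_; inj₁; inj₂; [_,_]′)
open import Data.Vec using (tabulate)
open import Data.Vec.Properties using (lookup∘tabulate; []=⇒lookup; lookup⇒[]=)
open import Function using (_∘_; mk⇔)
open import Relation.Binary.PropositionalEquality using (_≡_; _≢_; refl; sym; trans; cong; subst)
open import Relation.Nullary using (¬_; Dec; yes; no; does)
open import Relation.Nullary.Decidable using (dec-true; _→-dec_)
open import Relation.Unary using (Decidable)
open import Relation.Unary.Properties using (∁?)

module _ {n : ℕ} {P : Fin n → Set} (P? : Decidable P) where

  subset : Subset n
  subset = tabulate (does ∘ P?)

  ∈-subset⁺ : ∀ {x} → P x → x ∈ subset
  ∈-subset⁺ {x} px = lookup⇒[]= x subset (trans (lookup∘tabulate _ x) (dec-true (P? x) px))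

  ∈-subset⁻ : ∀ {x} → x ∈ subset → P x
  ∈-subset⁻ {x} x∈ with P? x | trans (sym (lookup∘tabulate (does ∘ P?) x)) ([]=⇒lookup x∈)
  ... | yes px | _ = px
  ... | no _   | ()

  length-filter+length-filter-∁ : ∀ (xs : List (Fin n)) →
    length (filter P? xs) + length (filter (∁? P?) xs) ≡ length xs
  length-filter+length-filter-∁ [] = refl
  length-filter+length-filter-∁ (x ∷ xs) with P? x
  ... | yes _ = cong suc (length-filter+length-filter-∁ xs)
  ... | no _  = trans (+-suc _ _) (cong suc (length-filter+length-filter-∁ xs))

AllPairs-mapWithAll : ∀ {A : Set} {P : A → Set} {R S : A → A → Set} {xs : List A} →
  (∀ {x y} → P x → P y → R x y → S x y) → All P xs → AllPairs R xs → AllPairs S xs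
AllPairs-mapWithAll f [] [] = []
AllPairs-mapWithAll f (px ∷ pxs) (rx ∷ rxs) =
  All.zipWith (λ (py , r) → f px py r) (pxs , rx) ∷ AllPairs-mapWithAll f pxs rxs

⌈m+n/2⌉≤m⊔n : ∀ m n → ⌈ m + n /2⌉ ≤ m ⊔ n
⌈m+n/2⌉≤m⊔n m n = ≤-trans (⌈n/2⌉-mono (+-mono-≤ (m≤m⊔n m n) (m≤n⊔m m n)))
                          (≤-reflexive (sym (n≡⌈n+n/2⌉ (m ⊔ n))))

another : ∀ {m} (v : Fin (suc (suc m))) → ∃ λ u → v ≢ u
another zero    = suc zero , λ ()
another (suc _) = zero , λ ()

module _ {n : ℕ} (G : Graph n) where

  adj-sym : ∀ {u v} → Adj G u v → Adj G v u
  adj-sym {u} {v} uv = trans (Graph.sym G v u) uv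

  adj? : ∀ u v → Dec (Adj G u v)
  adj? u v = adj G u v Bool.≟ true

  _⊑_ : Fin n → Fin n → Set
  v ⊑ u = ∀ w → Adj G v w → Adj G u w

  ⊑-refl : ∀ {v} → v ⊑ v
  ⊑-refl _ vw = vw

  _⊑?_ : ∀ v u → Dec (v ⊑ u)
  v ⊑? u = all? (λ w → adj? v w →-dec adj? u w)

  neighbours upperSet biclique : Fin n → Subset n
  neighbours v = subset (adj? v)
  upperSet v   = subset (v ⊑?_)
  biclique v   = upperSet v ∪ neighbours v

  walk⇒neighbour : ∀ {v u} → Walk G v u → v ≢ u → ∃ (Adj G v)
  walk⇒neighbour here         v≢v = ⊥-elim (v≢v refl)
  walk⇒neighbour (step vw _) _   = _ , vw

  connected⇒neighbour : 2 ≤ n → Connected G → ∀ v → ∃ (Adj G v)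
  connected⇒neighbour (s≤s (s≤s _)) connected v with another v
  ... | u , v≢u = walk⇒neighbour (connected v u) v≢u

  module Colouring (c : Fin n → Bool) (proper : ∀ u v → Adj G u v → c u ≢ c v)
           (neighbour : ∀ v → ∃ (Adj G v)) where

    adj⇒opposite : ∀ {u v} → Adj G u v → c u ≡ Bool.not (c v)
    adj⇒opposite {u} {v} uv = ¬-not (proper u v uv)

    ⊑⇒sameColour : ∀ {v u} → v ⊑ u → c u ≡ c v
    ⊑⇒sameColour {v} v⊑u with neighbour v
    ... | w , vw = trans (adj⇒opposite (v⊑u w vw)) (sym (adj⇒opposite vw))

    upperSet-sameColour : ∀ {v u} → u ∈ upperSet v → c u ≡ c v
    upperSet-sameColour {v} u∈ = ⊑⇒sameColour (∈-subset⁻ (v ⊑?_) u∈)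

    neighbours-opposite : ∀ {v u} → u ∈ neighbours v → c u ≡ Bool.not (c v)
    neighbours-opposite {v} u∈ = adj⇒opposite (adj-sym (∈-subset⁻ (adj? v) u∈))

    upperSet-disjoint-neighbours : ∀ {v x} → x ∈ upperSet v → x ∈ neighbours v → ⊥
    upperSet-disjoint-neighbours {v} {x} x∈U x∈N =
      proper v x (∈-subset⁻ (adj? v) x∈N) (sym (upperSet-sameColour x∈U))

    biclique-completeBipartite : ∀ v → IsCompleteBipartiteInduced G (biclique v)
    biclique-completeBipartite v =
        upperSet v , neighbours v
      , (v , ∈-subset⁺ (v ⊑?_) ⊑-refl)
      , (let w , vw = neighbour v in w , ∈-subset⁺ (adj? v) vw)
      , sides
      , p⊆p∪q (neighbours v) , q⊆p∪q (upperSet v) (neighbours v)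
      , (λ a b a∈ b∈ → ∈-subset⁻ (v ⊑?_) a∈ b (∈-subset⁻ (adj? v) b∈))
      , (λ a a′ a∈ a′∈ aa′ →
           proper a a′ aa′ (trans (upperSet-sameColour a∈) (sym (upperSet-sameColour a′∈))))
      , (λ b b′ b∈ b′∈ bb′ →
           proper b b′ bb′ (trans (neighbours-opposite b∈) (sym (neighbours-opposite b′∈))))
      where
      sides : ∀ x → x ∈ biclique v →
        (x ∈ upperSet v × ¬ x ∈ neighbours v) ⊎ (x ∈ neighbours v × ¬ x ∈ upperSet v)
      sides x x∈ with x∈p∪q⁻ (upperSet v) (neighbours v) x∈
      ... | inj₁ x∈U = inj₁ (x∈U , upperSet-disjoint-neighbours x∈U)
      ... | inj₂ x∈N = inj₂ (x∈N , λ x∈U → upperSet-disjoint-neighbours x∈U x∈N)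

    -- With v on the side P, every neighbour of v lies in T, hence on the side Q;
    -- so a vertex of P sees all of N(v), and a vertex of Q is a neighbour of v.
    ⊆-biclique : ∀ {v} (T P Q : Subset n) → v ∈ P → biclique v ⊆ T →
      (∀ x → x ∈ T → x ∈ P ⊎ x ∈ Q) →
      (∀ a b → a ∈ P → b ∈ Q → Adj G a b) →
      (∀ a a′ → a ∈ P → a′ ∈ P → ¬ Adj G a a′) →
      T ⊆ biclique v
    ⊆-biclique {v} T P Q v∈P S⊆T side complete independent {x} x∈T with side x x∈T
    ... | inj₂ x∈Q = q⊆p∪q (upperSet v) _ (∈-subset⁺ (adj? v) (complete v x v∈P x∈Q))
    ... | inj₁ x∈P = p⊆p∪q (neighbours v) (∈-subset⁺ (v ⊑?_) v⊑x)
      where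
      v⊑x : v ⊑ x
      v⊑x w vw with side w (S⊆T (q⊆p∪q (upperSet v) _ (∈-subset⁺ (adj? v) vw)))
      ... | inj₁ w∈P = ⊥-elim (independent v w v∈P w∈P vw)
      ... | inj₂ w∈Q = complete x w x∈P w∈Q

    biclique-maximal : ∀ v T → IsCompleteBipartiteInduced G T → biclique v ⊆ T → T ⊆ biclique v
    biclique-maximal v T (P , Q , _ , _ , sides , _ , _ , complete , indP , indQ) S⊆T =
      [ (λ v∈P → ⊆-biclique T P Q v∈P S⊆T side complete indP)
      , (λ v∈Q → ⊆-biclique T Q P v∈Q S⊆T (λ x → Sum.swap ∘ side x)
                   (λ a b a∈Q b∈P → adj-sym (complete b a b∈P a∈Q)) indQ)
      ]′ (side v (S⊆T (p⊆p∪q (neighbours v) (∈-subset⁺ (v ⊑?_) ⊑-refl))))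
      where
      side : ∀ x → x ∈ T → x ∈ P ⊎ x ∈ Q
      side x x∈T = Sum.map proj₁ proj₁ (sides x x∈T)

    biclique-isBiclique : ∀ v → IsBiclique G (biclique v)
    biclique-isBiclique v = biclique-completeBipartite v
      , λ T (S⊆T , x , x∈T , x∉S) T-cb → x∉S (biclique-maximal v T T-cb S⊆T x∈T)

    biclique-opposite⇒adj : ∀ {w u} → u ∈ biclique w → c u ≢ c w → Adj G w u
    biclique-opposite⇒adj {w} u∈ cu≢cw with x∈p∪q⁻ (upperSet w) (neighbours w) u∈
    ... | inj₁ u∈U = ⊥-elim (cu≢cw (upperSet-sameColour u∈U))
    ... | inj₂ u∈N = ∈-subset⁻ (adj? w) u∈N

    sameBiclique⇒⊑ : ∀ {v w} → c v ≡ c w → biclique v ≡ biclique w → v ⊑ w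
    sameBiclique⇒⊑ {v} {w} cv≡cw Sv≡Sw u vu = biclique-opposite⇒adj
      (subst (u ∈_) Sv≡Sw (q⊆p∪q (upperSet v) _ (∈-subset⁺ (adj? v) vu)))
      (λ cu≡cw → proper v u vu (trans cv≡cw (sym cu≡cw)))

    biclique-injective : NoFalseTwins G → ∀ {v w} → c v ≡ c w → v ≢ w → biclique v ≢ biclique w
    biclique-injective noTwins {v} {w} cv≡cw v≢w Sv≡Sw = noTwins v w (v≢w , λ u → ⇔→≡ (mk⇔
      (sameBiclique⇒⊑ cv≡cw Sv≡Sw u) (sameBiclique⇒⊑ (sym cv≡cw) (sym Sv≡Sw) u)))

    bicliques-of-colourClass : NoFalseTwins G → {P : Fin n → Set} (P? : Decidable P) →
      (∀ {x y} → P x → P y → c x ≡ c y) →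
      Σ (List (Subset n)) λ Bs → Unique Bs × All (IsBiclique G) Bs ×
        length Bs ≡ length (filter P? (allFin n))
    bicliques-of-colourClass noTwins P? sameColour =
        map biclique vs
      , AllPairsₚ.map⁺ (AllPairs-mapWithAll (λ px py → biclique-injective noTwins (sameColour px py))
                        (Allₚ.all-filter P? (allFin n)) (Uniqueₚ.filter⁺ P? (Uniqueₚ.allFin⁺ n)))
      , Allₚ.map⁺ (All.universal biclique-isBiclique vs)
      , length-map biclique vs
      where
      vs : List (Fin n)
      vs = filter P? (allFin n)

corollary4p6 : (n : ℕ) → 4 ≤ n → (G : Graph n) → Connected G → Bipartite G → NoFalseTwins G →
    Σ (List (Subset n)) λ Bs → Unique Bs × All (IsBiclique G) Bs × ⌈ n /2⌉ ≤ length Bs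
corollary4p6 n 4≤n G connected (c , proper) noTwins =
  [ atLeastHalf (bicliques-of-colourClass noTwins black? λ x y → trans x (sym y))
  , atLeastHalf (bicliques-of-colourClass noTwins (∁? black?) λ x y → trans (¬-not x) (sym (¬-not y)))
  ]′ (⊔-sel blacks whites)
  where
  open Colouring G c proper (connected⇒neighbour G (≤-trans (s≤s (s≤s z≤n)) 4≤n) connected)

  black? : Decidable (λ u → c u ≡ true)
  black? u = c u Bool.≟ true

  blacks whites : ℕ
  blacks = length (filter black? (allFin n))
  whites = length (filter (∁? black?) (allFin n))

  half≤larger : ⌈ n /2⌉ ≤ blacks ⊔ whites
  half≤larger = subst (λ m → ⌈ m /2⌉ ≤ blacks ⊔ whites)
    (trans (length-filter+length-filter-∁ black? (allFin n)) (length-tabulate (λ i → i)))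
    (⌈m+n/2⌉≤m⊔n blacks whites)

  atLeastHalf : ∀ {k} →
    (Σ (List (Subset n)) λ Bs → Unique Bs × All (IsBiclique G) Bs × length Bs ≡ k) → blacks ⊔ whites ≡ k →
    Σ (List (Subset n)) λ Bs → Unique Bs × All (IsBiclique G) Bs × ⌈ n /2⌉ ≤ length Bs
  atLeastHalf (Bs , unique , bicliques , length≡k) larger≡k =
    Bs , unique , bicliques , subst (⌈ n /2⌉ ≤_) (trans larger≡k (sym length≡k)) half≤larger
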